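{- Let $\mathbf{L}=\langle L,\leq\rangle$ be a complete algebraic lattice with $K$ its set of compact elements, $S$ a compact $L$-parameterization, and $C$ an algebraic $S$-closure operator. Let $\Sigma_C=\{a\Rightarrow b;\ a,b\in K,\ b\leq C(a)\}$. Then for all $a,b\in K$: if $\Sigma_C\vdash a\Rightarrow b$ then $a\Rightarrow b\in\Sigma_C$.
   Context: An isotone Galois connection in $\mathbf{L}$ is a pair $\langle f,h\rangle$ of maps $L\to L$ with $f(a)\leq b$ iff $a\leq h(b)$. An $L$-parameterization is a set $S$ of isotone Galois connections containing $\langle\mathrm{id},\mathrm{id}\rangle$; compact if $f(a)\in K$ whenever $a\in K$, $\langle f,h\rangle\in S$. An $S$-closure operator is $C\colon L\to L$ with $a\leq C(a)$, $a\leq b\Rightarrow C(a)\leq C(b)$, and $C(h(C(a)))\leq h(C(a))$ for all $a,b\in L$, $\langle f,h\rangle\in S$; algebraic if $C(a)=\bigvee\{C(c);\ c\in K,c\leq a\}$ for all $a$. A formula is a pair $a\Rightarrow b$ with $a,b\in K$. $S$-inference rules, for $a,b,c,d\in K$, $\langle f,h\rangle\in S$: infer $a\vee b\Rightarrow b$; from $a\Rightarrow b$ and $b\vee c\Rightarrow d$ infer $a\vee c\Rightarrow d$; from $a\Rightarrow b$ infer $f(a)\Rightarrow f(b)$. $\Sigma\vdash a\Rightarrow b$ means existence of a finite proof from $\Sigma$ using these rules. -}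

module Defs where

open import Level using (Lift; lift; lower)
open import Data.Bool using (Bool; true; false)
open import Data.Fin using (Fin)
open import Data.List using (List; length; lookup)
open import Data.Product using (Σ; ∃; _×_; proj₁)
open import Relation.Binary.PropositionalEquality using (_≡_)
open import Function using (id)

-- A complete lattice: a partial order (antisymmetric w.r.t. ≡) in which every
-- family (indexed by a type in Set₁, which covers Set-indexed families via Lift)
-- has a least upper bound ⋁.
record CompleteLattice : Set₂ where
  field
    Carrier   : Set
    _≤_       : Carrier → Carrier → Set
    ≤-refl    : ∀ {a} → a ≤ a
    ≤-trans   : ∀ {a b c} → a ≤ b → b ≤ c → a ≤ c
    ≤-antisym : ∀ {a b} → a ≤ b → b ≤ a → a ≡ b
    ⋁         : {I : Set₁} → (I → Carrier) → Carrier
    ⋁-upper   : {I : Set₁} (g : I → Carrier) (i : I) → g i ≤ ⋁ g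
    ⋁-least   : {I : Set₁} (g : I → Carrier) (u : Carrier) →
                (∀ i → g i ≤ u) → ⋁ g ≤ u

module _ (𝐋 : CompleteLattice) where
  open CompleteLattice 𝐋

  _∨_ : Carrier → Carrier → Carrier
  a ∨ b = ⋁ {I = Lift _ Bool} (λ { (lift true) → a ; (lift false) → b })

  finJoin : {I : Set} → (I → Carrier) → List I → Carrier
  finJoin g is = ⋁ {I = Lift _ (Fin (length is))} (λ k → g (lookup is (lower k)))

  IsCompact : Carrier → Set₁
  IsCompact a = (I : Set) (g : I → Carrier) →
                a ≤ ⋁ {I = Lift _ I} (λ i → g (lower i)) →
                ∃ λ (is : List I) → a ≤ finJoin g is

  IsAlgebraicLattice : Set
  IsAlgebraicLattice = ∀ a →
    a ≡ ⋁ {I = Σ Carrier (λ c → IsCompact c × c ≤ a)} proj₁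

  IsGaloisConnection : (Carrier → Carrier) → (Carrier → Carrier) → Set
  IsGaloisConnection f h = ∀ a b → (f a ≤ b → a ≤ h b) × (a ≤ h b → f a ≤ b)

  record Parameterization : Set₁ where
    field
      Mem   : (Carrier → Carrier) → (Carrier → Carrier) → Set
      isGC  : ∀ {f h} → Mem f h → IsGaloisConnection f h
      hasId : Mem id id

  open Parameterization public

  IsCompactParameterization : Parameterization → Set₁
  IsCompactParameterization S =
    ∀ {f h} → Mem S f h → ∀ a → IsCompact a → IsCompact (f a)

  record IsSClosure (S : Parameterization) (C : Carrier → Carrier) : Set where
    field
      extensive : ∀ a → a ≤ C a
      monotone  : ∀ a b → a ≤ b → C a ≤ C b
      closedH   : ∀ {f h} → Mem S f h → ∀ a → C (h (C a)) ≤ h (C a)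

  IsAlgebraicClosure : (Carrier → Carrier) → Set
  IsAlgebraicClosure C = ∀ a →
    C a ≡ ⋁ {I = Σ Carrier (λ c → IsCompact c × c ≤ a)} (λ i → C (proj₁ i))

  -- sets of formulas a ⇒ b (a predicate on pairs; membership of a ⇒ b)
  Formulas : Set₂
  Formulas = Carrier → Carrier → Set₁

  ΣC : (Carrier → Carrier) → Formulas
  ΣC C a b = IsCompact a × IsCompact b × b ≤ C a

  data Derivable (S : Parameterization) (Γ : Formulas) : Carrier → Carrier → Set₁ where
    hyp : ∀ {a b} → Γ a b → Derivable S Γ a b
    ax  : ∀ {a b} → IsCompact a → IsCompact b → Derivable S Γ (a ∨ b) b
    cut : ∀ {a b c d} → IsCompact a → IsCompact b → IsCompact c → IsCompact d →
          Derivable S Γ a b → Derivable S Γ (b ∨ c) d → Derivable S Γ (a ∨ c) d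
    par : ∀ {a b f h} → IsCompact a → IsCompact b → Mem S f h →
          Derivable S Γ a b → Derivable S Γ (f a) (f b)

-- Soundness: every inference rule preserves the relation b ≤ C a.  Reflexivity
-- and transitivity of the relation come from extensivity and idempotence of C
-- (idempotence being the closedness condition for ⟨id , id⟩); for a rule instance
-- ⟨f , h⟩, the element h (C (f a)) is C-closed and lies above a, so C a lies
-- below it, which is f (C a) ≤ C (f a) by adjunction.

module Submission where

open import Defs
open import Data.Product using (_,_; proj₁; proj₂)
open import Level using (lift)
open import Data.Bool using (true; false)

module _ (𝐋 : CompleteLattice) where
  open CompleteLattice 𝐋

  x≤x∨y : ∀ x y → x ≤ _∨_ 𝐋 x y
  x≤x∨y x y = ⋁-upper _ (lift true)

  y≤x∨y : ∀ x y → y ≤ _∨_ 𝐋 x y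
  y≤x∨y x y = ⋁-upper _ (lift false)

  ∨-least : ∀ {x y u} → x ≤ u → y ≤ u → _∨_ 𝐋 x y ≤ u
  ∨-least p q = ⋁-least _ _ λ { (lift true) → p ; (lift false) → q }

  module SClosureProperties {S : Parameterization 𝐋} {C : Carrier → Carrier}
                            (cl : IsSClosure 𝐋 S C) where
    open IsSClosure cl

    C-idempotent : ∀ a → C (C a) ≤ C a
    C-idempotent = closedH (hasId S)

    ≤C-trans : ∀ {a b d} → b ≤ C a → d ≤ C b → d ≤ C a
    ≤C-trans b≤Ca d≤Cb = ≤-trans d≤Cb (≤-trans (monotone _ _ b≤Ca) (C-idempotent _))

    ≤C-cut : ∀ {a b c d} → b ≤ C a → d ≤ C (_∨_ 𝐋 b c) → d ≤ C (_∨_ 𝐋 a c)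
    ≤C-cut {a} {b} {c} b≤Ca = ≤C-trans b∨c≤C[a∨c]
      where
      b∨c≤C[a∨c] : _∨_ 𝐋 b c ≤ C (_∨_ 𝐋 a c)
      b∨c≤C[a∨c] = ∨-least (≤-trans b≤Ca (monotone _ _ (x≤x∨y a c)))
                           (≤-trans (y≤x∨y a c) (extensive _))

    f-C≤C-f : ∀ {f h} → Mem S f h → ∀ a → f (C a) ≤ C (f a)
    f-C≤C-f {f} {h} m a = proj₂ (isGC S m (C a) (C (f a))) Ca≤h[C[fa]]
      where
      a≤h[C[fa]] : a ≤ h (C (f a))
      a≤h[C[fa]] = proj₁ (isGC S m a (C (f a))) (extensive (f a))

      Ca≤h[C[fa]] : C a ≤ h (C (f a))
      Ca≤h[C[fa]] = ≤-trans (monotone _ _ a≤h[C[fa]]) (closedH m (f a))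

    ≤C-map : ∀ {f h a b} → Mem S f h → b ≤ C a → f b ≤ C (f a)
    ≤C-map {f} {h} {a} {b} m b≤Ca = ≤-trans fb≤f[Ca] (f-C≤C-f m a)
      where
      fb≤f[Ca] : f b ≤ f (C a)
      fb≤f[Ca] = proj₂ (isGC S m b (f (C a)))
                       (≤-trans b≤Ca (proj₁ (isGC S m (C a) (f (C a))) ≤-refl))

    derivable⇒≤C : {Γ : Formulas 𝐋} → (∀ {a b} → Γ a b → b ≤ C a) →
                   ∀ {a b} → Derivable 𝐋 S Γ a b → b ≤ C a
    derivable⇒≤C Γ-sound (hyp γ)           = Γ-sound γ
    derivable⇒≤C Γ-sound (ax {a} {b} _ _)  = ≤-trans (y≤x∨y a b) (extensive _)
    derivable⇒≤C Γ-sound (cut _ _ _ _ D E) =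
      ≤C-cut (derivable⇒≤C Γ-sound D) (derivable⇒≤C Γ-sound E)
    derivable⇒≤C Γ-sound (par _ _ m D)     = ≤C-map m (derivable⇒≤C Γ-sound D)

lemma18 : (𝐋 : CompleteLattice) → IsAlgebraicLattice 𝐋 →
          (S : Parameterization 𝐋) → IsCompactParameterization 𝐋 S →
          (C : CompleteLattice.Carrier 𝐋 → CompleteLattice.Carrier 𝐋) →
          IsSClosure 𝐋 S C → IsAlgebraicClosure 𝐋 C →
          ∀ a b → IsCompact 𝐋 a → IsCompact 𝐋 b →
          Derivable 𝐋 S (ΣC 𝐋 C) a b → ΣC 𝐋 C a b
lemma18 𝐋 _ S _ C cl _ a b a-compact b-compact D =
  a-compact , b-compact , derivable⇒≤C (λ γ → proj₂ (proj₂ γ)) D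
  where open SClosureProperties 𝐋 cl
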